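{- Let $r\ge 1$ be an integer and $A\subseteq\mathbb{F}_2^r$. If $|A|\ge 2^{r-2}+3$, then $\Gamma(A)$ is triangle-free. Moreover, if $|A|>2^{r-2}+3$, then $D(A)$ is sum-free.
   Context: $\mathbb{F}_2^r$ denotes the elementary abelian $2$-group of rank $r$. For $X\subseteq\mathbb{F}_2^r$, $2X:=\{x_1+x_2\colon x_1,x_2\in X\}$ (with $x_1=x_2$ allowed); $X$ is sum-free if $X\cap 2X=\varnothing$. For $A\subseteq\mathbb{F}_2^r$, $D(A)$ is the set of elements of $\mathbb{F}_2^r$ having exactly one representation, up to the order of summands, as $a_1+a_2$ with $a_1,a_2\in A$. The unique representation graph $\Gamma(A)$ is the graph with vertex set $A$ in which distinct $a_1,a_2\in A$ are adjacent iff $a_1+a_2\in D(A)$. -}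

module Defs where

open import Data.Bool using (Bool; _xor_)
open import Data.Vec using (Vec; zipWith)
open import Data.List using (List; length)
open import Data.List.Membership.Propositional using (_∈_)
open import Data.Product using (Σ; ∃; _×_; _,_)
open import Data.Sum using (_⊎_)
open import Relation.Binary.PropositionalEquality using (_≡_; _≢_)
open import Relation.Nullary using (¬_)

F₂^ : (r : _) → Set
F₂^ r = Vec Bool r

infixl 6 _⊕_
_⊕_ : ∀ {r} → F₂^ r → F₂^ r → F₂^ r
_⊕_ = zipWith _xor_

-- A finite subset of F_2^r is given as a duplicate-free list (see Statement);
-- its cardinality is the length of the list.

RepBy : ∀ {r} → List (F₂^ r) → F₂^ r → F₂^ r → F₂^ r → Set
RepBy A x a₁ a₂ = a₁ ∈ A × a₂ ∈ A × a₁ ⊕ a₂ ≡ x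

-- x ∈ D(A): exactly one representation up to the order of summands
InD : ∀ {r} → List (F₂^ r) → F₂^ r → Set
InD A x = Σ (F₂^ _) λ a₁ → Σ (F₂^ _) λ a₂ → RepBy A x a₁ a₂ ×
  (∀ b₁ b₂ → RepBy A x b₁ b₂ → (b₁ ≡ a₁ × b₂ ≡ a₂) ⊎ (b₁ ≡ a₂ × b₂ ≡ a₁))

Adj : ∀ {r} → List (F₂^ r) → F₂^ r → F₂^ r → Set
Adj A a₁ a₂ = a₁ ∈ A × a₂ ∈ A × a₁ ≢ a₂ × InD A (a₁ ⊕ a₂)

TriangleFree : ∀ {r} → List (F₂^ r) → Set
TriangleFree {r} A = ∀ (a b c : F₂^ r) → ¬ (Adj A a b × Adj A b c × Adj A a c)

SumFree : ∀ {r} → (F₂^ r → Set) → Set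
SumFree {r} X = ∀ (x₁ x₂ : F₂^ r) → X x₁ → X x₂ → ¬ X (x₁ ⊕ x₂)

module Submission where

-- Let x, y and z = x + y be nonzero elements of D(A).  For p ∈ F₂^r look at
-- the four points p, p + x, p + y, p + z and let k of them lie in A.  Since
-- k ≤ 1 + (k choose 2) for k ≤ 4, summing over all p gives
--     4|A| = Σ_p k(p) ≤ 2^r + Σ_p (k(p) choose 2) = 2^r + 6 · 2,
-- because each translate A + u has |A| elements, and for every pair {u, v}
-- of the subgroup {0, x, y, z} the number of p with p + u, p + v ∈ A is the
-- number of ordered representations of u + v ∈ D(A), namely 2.  The
-- inequality is strict if some p has k(p) ≥ 3.
-- A triangle a, b, c in Γ(A) gives x = a + b, y = a + c, z = b + c in D(A)
-- and a point p = a with k(p) ≥ 3, so 4|A| < 2^r + 12; if D(A) were not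
-- sum-free we would get x, y, x + y ∈ D(A) and 4|A| ≤ 2^r + 12.
-- The file develops: Iverson brackets, the group laws of F₂^r, sums over
-- F₂^r, the two counting identities, the four-point inequality, the bound,
-- and finally the theorem.

open import Defs
open import Data.Nat using (ℕ; zero; suc; _≤_; _<_; _+_; _*_; _^_; z≤n; s≤s)
open import Data.Nat.Properties
  using ( +-identityʳ; +-comm; +-mono-≤; +-mono-<-≤; +-mono-≤-<; ≤ᵇ⇒≤
        ; m+n≤o⇒n≤o; <⇒≤; <⇒≱; +-commutativeSemigroup)
open import Algebra.Properties.CommutativeSemigroup +-commutativeSemigroup
  using (interchange)
open import Data.Bool using (Bool; true; false; _∧_)
import Data.Bool.Properties as Bool
open import Data.Vec using ([]; _∷_; replicate)
import Data.Vec.Properties as Vec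
open import Data.List using (List; []; _∷_; length; map)
open import Data.Nat.ListAction using (sum)
open import Data.List.Properties using (map-cong; map-cong-local)
open import Data.List.Membership.Propositional using (_∈_)
open import Data.List.Relation.Unary.Any using (here; there; any?)
open import Data.List.Relation.Unary.All using ([]; _∷_)
import Data.List.Relation.Unary.All as All
open import Data.List.Relation.Unary.AllPairs using ([]; _∷_)
open import Data.List.Relation.Unary.Unique.Propositional using (Unique)
open import Data.Product using (_×_; _,_; uncurry)
open import Data.Sum using (inj₁; inj₂)
open import Data.Empty using (⊥-elim)
open import Relation.Nullary using (¬_; Dec; yes; no; does; _×-dec_; _⊎-dec_)
open import Relation.Nullary.Decidable using (dec-true)
open import Relation.Binary.Definitions using (DecidableEquality)
open import Relation.Binary.PropositionalEquality
open ≡-Reasoning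

bit : Bool → ℕ
bit true  = 1
bit false = 0

⟦_⟧ : {P : Set} → Dec P → ℕ
⟦ P? ⟧ = bit (does P?)

⟦⟧-⇔ : {P Q : Set} (P? : Dec P) (Q? : Dec Q) → (P → Q) → (Q → P) → ⟦ P? ⟧ ≡ ⟦ Q? ⟧
⟦⟧-⇔ P? Q? P→Q Q→P with P? | Q?
... | yes _ | yes _  = refl
... | no _  | no _   = refl
... | yes p | no ¬q  = ⊥-elim (¬q (P→Q p))
... | no ¬p | yes q  = ⊥-elim (¬p (Q→P q))

⟦⟧-× : {P Q : Set} (P? : Dec P) (Q? : Dec Q) → ⟦ P? ⟧ * ⟦ Q? ⟧ ≡ ⟦ P? ×-dec Q? ⟧
⟦⟧-× P? Q? = bit-∧ (does P?) (does Q?)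
  where
  bit-∧ : ∀ b c → bit b * bit c ≡ bit (b ∧ c)
  bit-∧ false _     = refl
  bit-∧ true  true  = refl
  bit-∧ true  false = refl

⟦⟧-⊎ : {P Q : Set} (P? : Dec P) (Q? : Dec Q) → ¬ (P × Q) → ⟦ P? ⊎-dec Q? ⟧ ≡ ⟦ P? ⟧ + ⟦ Q? ⟧
⟦⟧-⊎ P? Q? exclusive with P? | Q?
... | yes p | yes q = ⊥-elim (exclusive (p , q))
... | yes _ | no _  = refl
... | no _  | yes _ = refl
... | no _  | no _  = refl

𝟘 : ∀ {r} → F₂^ r
𝟘 = replicate _ false

⊕-assoc : ∀ {r} (a b c : F₂^ r) → (a ⊕ b) ⊕ c ≡ a ⊕ (b ⊕ c)
⊕-assoc = Vec.zipWith-assoc Bool.xor-assoc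

⊕-comm : ∀ {r} (a b : F₂^ r) → a ⊕ b ≡ b ⊕ a
⊕-comm = Vec.zipWith-comm Bool.xor-comm

⊕-identityˡ : ∀ {r} (a : F₂^ r) → 𝟘 ⊕ a ≡ a
⊕-identityˡ = Vec.zipWith-identityˡ Bool.xor-identityˡ

⊕-identityʳ : ∀ {r} (a : F₂^ r) → a ⊕ 𝟘 ≡ a
⊕-identityʳ = Vec.zipWith-identityʳ Bool.xor-identityʳ

⊕-self : ∀ {r} (a : F₂^ r) → a ⊕ a ≡ 𝟘
⊕-self []      = refl
⊕-self (b ∷ a) = cong₂ _∷_ (Bool.xor-same b) (⊕-self a)

⊕-cancelˡ : ∀ {r} (a b : F₂^ r) → a ⊕ (a ⊕ b) ≡ b
⊕-cancelˡ a b = begin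
  a ⊕ (a ⊕ b)  ≡⟨ ⊕-assoc a a b ⟨
  (a ⊕ a) ⊕ b  ≡⟨ cong (_⊕ b) (⊕-self a) ⟩
  𝟘 ⊕ b        ≡⟨ ⊕-identityˡ b ⟩
  b            ∎

⊕-cancelʳ : ∀ {r} (a b : F₂^ r) → (a ⊕ b) ⊕ b ≡ a
⊕-cancelʳ a b = begin
  (a ⊕ b) ⊕ b  ≡⟨ ⊕-assoc a b b ⟩
  a ⊕ (b ⊕ b)  ≡⟨ cong (a ⊕_) (⊕-self b) ⟩
  a ⊕ 𝟘        ≡⟨ ⊕-identityʳ a ⟩
  a            ∎

⊕≡𝟘⇒≡ : ∀ {r} (a b : F₂^ r) → a ⊕ b ≡ 𝟘 → a ≡ b
⊕≡𝟘⇒≡ a b a⊕b≡𝟘 = begin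
  a            ≡⟨ ⊕-cancelʳ a b ⟨
  (a ⊕ b) ⊕ b  ≡⟨ cong (_⊕ b) a⊕b≡𝟘 ⟩
  𝟘 ⊕ b        ≡⟨ ⊕-identityˡ b ⟩
  b            ∎

⊕-difference : ∀ {r} (a b c : F₂^ r) → (a ⊕ b) ⊕ (a ⊕ c) ≡ b ⊕ c
⊕-difference a b c = begin
  (a ⊕ b) ⊕ (a ⊕ c)  ≡⟨ cong (_⊕ (a ⊕ c)) (⊕-comm a b) ⟩
  (b ⊕ a) ⊕ (a ⊕ c)  ≡⟨ ⊕-assoc b a (a ⊕ c) ⟩
  b ⊕ (a ⊕ (a ⊕ c))  ≡⟨ cong (b ⊕_) (⊕-cancelˡ a c) ⟩
  b ⊕ c              ∎

_≟_ : ∀ {r} → DecidableEquality (F₂^ r)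
_≟_ = Vec.≡-dec Bool._≟_

infix 4 _∈?_
_∈?_ : ∀ {r} (q : F₂^ r) (L : List (F₂^ r)) → Dec (q ∈ L)
q ∈? L = any? (q ≟_) L

χ : ∀ {r} → List (F₂^ r) → F₂^ r → ℕ
χ L q = ⟦ q ∈? L ⟧

∑ : ∀ r → (F₂^ r → ℕ) → ℕ
∑ zero    f = f []
∑ (suc r) f = ∑ r (λ v → f (true ∷ v)) + ∑ r (λ v → f (false ∷ v))

∑-cong : ∀ r {f g : F₂^ r → ℕ} → (∀ p → f p ≡ g p) → ∑ r f ≡ ∑ r g
∑-cong zero    f≡g = f≡g []
∑-cong (suc r) f≡g =
  cong₂ _+_ (∑-cong r (λ v → f≡g (true ∷ v))) (∑-cong r (λ v → f≡g (false ∷ v)))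

∑-mono-≤ : ∀ r {f g : F₂^ r → ℕ} → (∀ p → f p ≤ g p) → ∑ r f ≤ ∑ r g
∑-mono-≤ zero    f≤g = f≤g []
∑-mono-≤ (suc r) f≤g =
  +-mono-≤ (∑-mono-≤ r (λ v → f≤g (true ∷ v))) (∑-mono-≤ r (λ v → f≤g (false ∷ v)))

∑-mono-< : ∀ r {f g : F₂^ r → ℕ} → (∀ p → f p ≤ g p) → ∀ q → f q < g q → ∑ r f < ∑ r g
∑-mono-< zero    f≤g []          fq<gq = fq<gq
∑-mono-< (suc r) f≤g (true ∷ q)  fq<gq =
  +-mono-<-≤ (∑-mono-< r (λ v → f≤g (true ∷ v)) q fq<gq) (∑-mono-≤ r (λ v → f≤g (false ∷ v)))
∑-mono-< (suc r) f≤g (false ∷ q) fq<gq =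
  +-mono-≤-< (∑-mono-≤ r (λ v → f≤g (true ∷ v))) (∑-mono-< r (λ v → f≤g (false ∷ v)) q fq<gq)

∑-0 : ∀ r → ∑ r (λ _ → 0) ≡ 0
∑-0 zero    = refl
∑-0 (suc r) = cong₂ _+_ (∑-0 r) (∑-0 r)

∑-1 : ∀ r → ∑ r (λ _ → 1) ≡ 2 ^ r
∑-1 zero    = refl
∑-1 (suc r) = cong₂ _+_ (∑-1 r) (trans (∑-1 r) (sym (+-identityʳ (2 ^ r))))

∑-+ : ∀ r (f g : F₂^ r → ℕ) → ∑ r (λ p → f p + g p) ≡ ∑ r f + ∑ r g
∑-+ zero    f g = refl
∑-+ (suc r) f g = trans
  (cong₂ _+_ (∑-+ r (λ v → f (true ∷ v)) (λ v → g (true ∷ v)))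
             (∑-+ r (λ v → f (false ∷ v)) (λ v → g (false ∷ v))))
  (interchange (∑ r (λ v → f (true ∷ v))) (∑ r (λ v → g (true ∷ v)))
               (∑ r (λ v → f (false ∷ v))) (∑ r (λ v → g (false ∷ v))))

∑-sum : ∀ r {I : Set} (f : I → F₂^ r → ℕ) (is : List I) →
  ∑ r (λ p → sum (map (λ i → f i p) is)) ≡ sum (map (λ i → ∑ r (f i)) is)
∑-sum r f []       = ∑-0 r
∑-sum r f (i ∷ is) =
  trans (∑-+ r (f i) (λ p → sum (map (λ j → f j p) is))) (cong (∑ r (f i) +_) (∑-sum r f is))

-- Translation invariance: p ↦ p + u permutes F₂^r.  Translating by a vector
-- starting with true swaps the two halves of the sum.
∑-translate : ∀ r (f : F₂^ r → ℕ) (u : F₂^ r) → ∑ r (λ p → f (p ⊕ u)) ≡ ∑ r f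
∑-translate zero    f []          = refl
∑-translate (suc r) f (false ∷ u) =
  cong₂ _+_ (∑-translate r (λ v → f (true ∷ v)) u) (∑-translate r (λ v → f (false ∷ v)) u)
∑-translate (suc r) f (true ∷ u)  = trans
  (cong₂ _+_ (∑-translate r (λ v → f (false ∷ v)) u) (∑-translate r (λ v → f (true ∷ v)) u))
  (+-comm (∑ r (λ v → f (false ∷ v))) (∑ r (λ v → f (true ∷ v))))

∑-δ : ∀ r (x : F₂^ r) → ∑ r (λ q → ⟦ q ≟ x ⟧) ≡ 1
∑-δ zero    []          = refl
∑-δ (suc r) (true ∷ x)  = cong₂ _+_ (∑-δ r x) (∑-0 r)
∑-δ (suc r) (false ∷ x) = cong₂ _+_ (∑-0 r) (∑-δ r x)

∑-χ : ∀ r (L : List (F₂^ r)) → Unique L → ∑ r (χ L) ≡ length L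
∑-χ r []      _             = ∑-0 r
∑-χ r (x ∷ L) (x∉L ∷ uniqueL) = begin
  ∑ r (χ (x ∷ L))                        ≡⟨ ∑-cong r split ⟩
  ∑ r (λ q → ⟦ q ≟ x ⟧ + χ L q)          ≡⟨ ∑-+ r (λ q → ⟦ q ≟ x ⟧) (χ L) ⟩
  ∑ r (λ q → ⟦ q ≟ x ⟧) + ∑ r (χ L)      ≡⟨ cong₂ _+_ (∑-δ r x) (∑-χ r L uniqueL) ⟩
  suc (length L)                         ∎
  where
  split : ∀ q → χ (x ∷ L) q ≡ ⟦ q ≟ x ⟧ + χ L q
  split q = ⟦⟧-⊎ (q ≟ x) (q ∈? L) (λ (q≡x , q∈L) → All.lookup x∉L q∈L (sym q≡x))

module Counting {r : ℕ} (A : List (F₂^ r)) where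

  translate-count : Unique A → ∀ u → ∑ r (λ p → χ A (p ⊕ u)) ≡ length A
  translate-count uniqueA u = trans (∑-translate r (χ A) u) (∑-χ r A uniqueA)

  representations : F₂^ r → ℕ
  representations w = ∑ r (λ q → χ A q * χ A (q ⊕ w))

  intersection : ∀ u v → ∑ r (λ p → χ A (p ⊕ u) * χ A (p ⊕ v)) ≡ representations (u ⊕ v)
  intersection u v = begin
    ∑ r (λ p → χ A (p ⊕ u) * χ A (p ⊕ v))
      ≡⟨ ∑-cong r (λ p → cong (λ q → χ A (p ⊕ u) * χ A q) (shift p)) ⟩
    ∑ r (λ p → χ A (p ⊕ u) * χ A ((p ⊕ u) ⊕ (u ⊕ v)))
      ≡⟨ ∑-translate r (λ q → χ A q * χ A (q ⊕ (u ⊕ v))) u ⟩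
    representations (u ⊕ v) ∎
    where
    shift : ∀ p → p ⊕ v ≡ (p ⊕ u) ⊕ (u ⊕ v)
    shift p = sym (trans (⊕-assoc p u (u ⊕ v)) (cong (p ⊕_) (⊕-cancelˡ u v)))

  -- A nonzero w ∈ D(A) has exactly the two ordered representations
  -- (a₁, a₂) and (a₂, a₁), which are distinct because a₁ + a₂ ≠ 0.
  D-representations : ∀ {w} → InD A w → w ≢ 𝟘 → representations w ≡ 2
  D-representations {w} (a₁ , a₂ , (a₁∈A , a₂∈A , a₁⊕a₂≡w) , unique) w≢𝟘 = begin
    representations w       ≡⟨ ∑-cong r (λ q → trans (⟦⟧-× (q ∈? A) (q ⊕ w ∈? A)) (⟦⟧-⇔ (q ∈? A ×-dec q ⊕ w ∈? A) (q ∈? a₁ ∷ a₂ ∷ []) to from)) ⟩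
    ∑ r (χ (a₁ ∷ a₂ ∷ []))  ≡⟨ ∑-χ r (a₁ ∷ a₂ ∷ []) ((a₁≢a₂ ∷ []) ∷ [] ∷ []) ⟩
    2                       ∎
    where
    a₁≢a₂ : a₁ ≢ a₂
    a₁≢a₂ refl = w≢𝟘 (trans (sym a₁⊕a₂≡w) (⊕-self a₁))
    a₁⊕w≡a₂ : a₁ ⊕ w ≡ a₂
    a₁⊕w≡a₂ = trans (cong (a₁ ⊕_) (sym a₁⊕a₂≡w)) (⊕-cancelˡ a₁ a₂)
    a₂⊕w≡a₁ : a₂ ⊕ w ≡ a₁
    a₂⊕w≡a₁ = trans (cong (a₂ ⊕_) (trans (sym a₁⊕a₂≡w) (⊕-comm a₁ a₂))) (⊕-cancelˡ a₂ a₁)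
    to : ∀ {q} → q ∈ A × q ⊕ w ∈ A → q ∈ a₁ ∷ a₂ ∷ []
    to {q} (q∈A , q⊕w∈A) with unique q (q ⊕ w) (q∈A , q⊕w∈A , ⊕-cancelˡ q w)
    ... | inj₁ (q≡a₁ , _) = here q≡a₁
    ... | inj₂ (q≡a₂ , _) = there (here q≡a₂)
    from : ∀ {q} → q ∈ a₁ ∷ a₂ ∷ [] → q ∈ A × q ⊕ w ∈ A
    from (here refl)         = a₁∈A , subst (_∈ A) (sym a₁⊕w≡a₂) a₂∈A
    from (there (here refl)) = a₂∈A , subst (_∈ A) (sym a₂⊕w≡a₁) a₁∈A

-- If |A| ≥ 2 then 0 ∉ D(A): every a ∈ A gives the representation 0 = a + a.
D-nonzero : ∀ {r} {A : List (F₂^ r)} → Unique A → 1 < length A → ∀ {w} → InD A w → w ≢ 𝟘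
D-nonzero {A = []}        _ ()
D-nonzero {A = _ ∷ []}    _ (s≤s ())
D-nonzero {A = a ∷ b ∷ A} ((a≢b ∷ _) ∷ _) _ (a₁ , a₂ , (_ , _ , a₁⊕a₂≡𝟘) , unique) refl =
  a≢b (trans (onlyRepresentation a (here refl)) (sym (onlyRepresentation b (there (here refl)))))
  where
  onlyRepresentation : ∀ c → c ∈ a ∷ b ∷ A → c ≡ a₁
  onlyRepresentation c c∈A with unique c c (c∈A , c∈A , ⊕-self c)
  ... | inj₁ (c≡a₁ , _) = c≡a₁
  ... | inj₂ (c≡a₂ , _) = trans c≡a₂ (sym (⊕≡𝟘⇒≡ a₁ a₂ a₁⊕a₂≡𝟘))

many-elements : ∀ m n → m + 12 ≤ 4 * n → 1 < n
many-elements m n large = go n (m+n≤o⇒n≤o m large)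
  where
  go : ∀ n → 12 ≤ 4 * n → 1 < n
  go (suc (suc n)) _ = s≤s (s≤s z≤n)
  go 1 (s≤s (s≤s (s≤s (s≤s ()))))

members : Bool → Bool → Bool → Bool → ℕ
members b₀ b₁ b₂ b₃ = sum (map bit (b₀ ∷ b₁ ∷ b₂ ∷ b₃ ∷ []))

memberPairs : Bool → Bool → Bool → Bool → ℕ
memberPairs b₀ b₁ b₂ b₃ = sum (map (λ (b , c) → bit b * bit c)
  ((b₀ , b₁) ∷ (b₀ , b₂) ∷ (b₀ , b₃) ∷ (b₁ , b₂) ∷ (b₁ , b₃) ∷ (b₂ , b₃) ∷ []))

members≤ : ∀ b₀ b₁ b₂ b₃ → members b₀ b₁ b₂ b₃ ≤ 1 + memberPairs b₀ b₁ b₂ b₃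
members≤ false false false false = ≤ᵇ⇒≤ _ _ _
members≤ false false false true  = ≤ᵇ⇒≤ _ _ _
members≤ false false true  false = ≤ᵇ⇒≤ _ _ _
members≤ false false true  true  = ≤ᵇ⇒≤ _ _ _
members≤ false true  false false = ≤ᵇ⇒≤ _ _ _
members≤ false true  false true  = ≤ᵇ⇒≤ _ _ _
members≤ false true  true  false = ≤ᵇ⇒≤ _ _ _
members≤ false true  true  true  = ≤ᵇ⇒≤ _ _ _
members≤ true  false false false = ≤ᵇ⇒≤ _ _ _
members≤ true  false false true  = ≤ᵇ⇒≤ _ _ _
members≤ true  false true  false = ≤ᵇ⇒≤ _ _ _
members≤ true  false true  true  = ≤ᵇ⇒≤ _ _ _
members≤ true  true  false false = ≤ᵇ⇒≤ _ _ _
members≤ true  true  false true  = ≤ᵇ⇒≤ _ _ _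
members≤ true  true  true  false = ≤ᵇ⇒≤ _ _ _
members≤ true  true  true  true  = ≤ᵇ⇒≤ _ _ _

members< : ∀ {b₀ b₁ b₂} b₃ → b₀ ≡ true → b₁ ≡ true → b₂ ≡ true →
  members b₀ b₁ b₂ b₃ < 1 + memberPairs b₀ b₁ b₂ b₃
members< false refl refl refl = ≤ᵇ⇒≤ 4 4 _
members< true  refl refl refl = ≤ᵇ⇒≤ 5 7 _

module Bound {r : ℕ} (A : List (F₂^ r)) (uniqueA : Unique A)
  (D≢𝟘 : ∀ {w} → InD A w → w ≢ 𝟘) {x y : F₂^ r}
  (x∈D : InD A x) (y∈D : InD A y) (x⊕y∈D : InD A (x ⊕ y)) where

  open Counting A

  in-translate : F₂^ r → F₂^ r → Bool
  in-translate u p = does (p ⊕ u ∈? A)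

  H : List (F₂^ r)
  H = 𝟘 ∷ x ∷ y ∷ x ⊕ y ∷ []

  pairsH : List (F₂^ r × F₂^ r)
  pairsH = (𝟘 , x) ∷ (𝟘 , y) ∷ (𝟘 , x ⊕ y) ∷ (x , y) ∷ (x , x ⊕ y) ∷ (y , x ⊕ y) ∷ []

  meet : F₂^ r → F₂^ r → F₂^ r → ℕ
  meet u v p = χ A (p ⊕ u) * χ A (p ⊕ v)

  k : F₂^ r → ℕ
  k p = members (in-translate 𝟘 p) (in-translate x p) (in-translate y p) (in-translate (x ⊕ y) p)

  k₂ : F₂^ r → ℕ
  k₂ p = memberPairs (in-translate 𝟘 p) (in-translate x p) (in-translate y p) (in-translate (x ⊕ y) p)

  ∑k : ∑ r k ≡ 4 * length A
  ∑k = begin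
    ∑ r k                                              ≡⟨ ∑-sum r (λ u p → χ A (p ⊕ u)) H ⟩
    sum (map (λ u → ∑ r (λ p → χ A (p ⊕ u))) H)        ≡⟨ cong sum (map-cong (translate-count uniqueA) H) ⟩
    sum (map (λ _ → length A) H)                       ∎

  pair-meets : ∀ {u v w} → u ⊕ v ≡ w → InD A w → ∑ r (meet u v) ≡ 2
  pair-meets {u} {v} refl w∈D = trans (intersection u v) (D-representations w∈D (D≢𝟘 w∈D))

  ∑k₂ : ∑ r k₂ ≡ 12
  ∑k₂ = begin
    ∑ r k₂                                      ≡⟨ ∑-sum r (uncurry meet) pairsH ⟩
    sum (map (λ i → ∑ r (uncurry meet i)) pairsH)
      ≡⟨ cong sum (map-cong-local {f = λ i → ∑ r (uncurry meet i)} {g = λ _ → 2}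
           ( pair-meets (⊕-identityˡ x) x∈D ∷ pair-meets (⊕-identityˡ y) y∈D
           ∷ pair-meets (⊕-identityˡ (x ⊕ y)) x⊕y∈D ∷ pair-meets refl x⊕y∈D
           ∷ pair-meets (⊕-cancelˡ x y) y∈D
           ∷ pair-meets (trans (cong (y ⊕_) (⊕-comm x y)) (⊕-cancelˡ y x)) x∈D ∷ [])) ⟩
    12                                          ∎

  ∑[1+k₂] : ∑ r (λ p → 1 + k₂ p) ≡ 2 ^ r + 12
  ∑[1+k₂] = trans (∑-+ r (λ _ → 1) k₂) (cong₂ _+_ (∑-1 r) ∑k₂)

  pointwise : ∀ p → k p ≤ 1 + k₂ p
  pointwise p = members≤ (in-translate 𝟘 p) (in-translate x p) (in-translate y p) (in-translate (x ⊕ y) p)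

  bound : 4 * length A ≤ 2 ^ r + 12
  bound = subst₂ _≤_ ∑k ∑[1+k₂] (∑-mono-≤ r pointwise)

  bound-strict : ∀ a → a ∈ A → a ⊕ x ∈ A → a ⊕ y ∈ A → 4 * length A < 2 ^ r + 12
  bound-strict a a∈A a⊕x∈A a⊕y∈A = subst₂ _<_ ∑k ∑[1+k₂] (∑-mono-< r pointwise a
    (members< (in-translate (x ⊕ y) a)
      (dec-true (a ⊕ 𝟘 ∈? A) (subst (_∈ A) (sym (⊕-identityʳ a)) a∈A))
      (dec-true (a ⊕ x ∈? A) a⊕x∈A) (dec-true (a ⊕ y ∈? A) a⊕y∈A)))

proposition3p5 : (r : ℕ) → 1 ≤ r → (A : List (F₂^ r)) → Unique A →
    (2 ^ r + 12 ≤ 4 * length A → TriangleFree A) ×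
    (2 ^ r + 12 < 4 * length A → SumFree (InD A))
proposition3p5 r _ A uniqueA = triangle-free , sum-free
  where
  D≢𝟘 : 2 ^ r + 12 ≤ 4 * length A → ∀ {w} → InD A w → w ≢ 𝟘
  D≢𝟘 large = D-nonzero uniqueA (many-elements (2 ^ r) (length A) large)

  -- A triangle a, b, c yields a + b, a + c, b + c ∈ D(A) and the point a
  -- lying in A, A + (a + b) and A + (a + c).
  triangle-free : 2 ^ r + 12 ≤ 4 * length A → TriangleFree A
  triangle-free large a b c ((a∈A , b∈A , _ , a⊕b∈D) , (_ , c∈A , _ , b⊕c∈D) , (_ , _ , _ , a⊕c∈D)) =
    <⇒≱ (Bound.bound-strict A uniqueA (D≢𝟘 large) a⊕b∈D a⊕c∈D
           (subst (InD A) (sym (⊕-difference a b c)) b⊕c∈D)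
           a a∈A (subst (_∈ A) (sym (⊕-cancelˡ a b)) b∈A) (subst (_∈ A) (sym (⊕-cancelˡ a c)) c∈A))
        large

  sum-free : 2 ^ r + 12 < 4 * length A → SumFree (InD A)
  sum-free larger x₁ x₂ x₁∈D x₂∈D x₁⊕x₂∈D =
    <⇒≱ larger (Bound.bound A uniqueA (D≢𝟘 (<⇒≤ larger)) x₁∈D x₂∈D x₁⊕x₂∈D)
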